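{- Let $i$ be a positive integer and let $G'$ be the threshold graph with binary sequence $(0^{2i+2} 1^{3i} 0^{2i+1} 1^{2i+2})$ (so $G'$ has $9i+5$ vertices). Then, to within a sign, the characteristic polynomial of (the adjacency matrix of) $G'$ is $$P_{G'}(x) = x^{4i+1} (x+1)^{5i} (x+2i+2)\left(x^3 -(7i+2)x^2 -(7i+3)x +12i^3 +18i^2 +6i\right).$$
   Context: A threshold graph on $N$ vertices is coded by a binary sequence $(b_1 b_2 \ldots b_N)$ with $b_1=0$: vertices $v_1,\dots,v_N$ are added in order, and for $j\ge 2$ the vertex $v_j$ is added as an isolated vertex if $b_j=0$ and as a dominating vertex (adjacent to all of $v_1,\dots,v_{j-1}$) if $b_j=1$. Thus for $k<j$, $v_k$ is adjacent to $v_j$ iff $b_j=1$. The notation $(0^{a_1} 1^{a_2} 0^{a_3} 1^{a_4}\cdots)$ denotes the sequence consisting of $a_1$ zeros, followed by $a_2$ ones, followed by $a_3$ zeros, etc. The characteristic polynomial of a graph is that of its adjacency matrix. -}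

module Defs where

open import Data.Nat using (ℕ; zero; suc; _<ᵇ_)
import Data.Nat as ℕ
open import Data.Integer using (ℤ; +_; -_; _+_; _*_)
open import Data.Bool using (Bool; true; false; if_then_else_)
open import Data.Fin using (Fin; zero; suc; toℕ; punchIn)
open import Data.List using (List; []; _∷_; _++_; replicate; length; lookup; map)
open import Data.Product using (_×_; _,_)
open import Relation.Binary.PropositionalEquality using (_≡_)

-- Polynomials over ℤ as coefficient lists (constant term first).

Poly : Set
Poly = List ℤ

addP : Poly → Poly → Poly
addP []       q        = q
addP (a ∷ p)  []       = a ∷ p
addP (a ∷ p)  (b ∷ q)  = (a + b) ∷ addP p q

negP : Poly → Poly
negP = map -_

subP : Poly → Poly → Poly
subP p q = addP p (negP q)

scaleP : ℤ → Poly → Poly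
scaleP a = map (a *_)

mulP : Poly → Poly → Poly
mulP []       q = []
mulP (a ∷ p)  q = addP (scaleP a q) ((+ 0) ∷ mulP p q)

constP : ℤ → Poly
constP a = a ∷ []

X : Poly
X = (+ 0) ∷ (+ 1) ∷ []

powP : Poly → ℕ → Poly
powP p zero    = constP (+ 1)
powP p (suc n) = mulP p (powP p n)

coeff : Poly → ℕ → ℤ
coeff []       n       = + 0
coeff (a ∷ p)  zero    = a
coeff (a ∷ p)  (suc n) = coeff p n

_≈P_ : Poly → Poly → Set
p ≈P q = ∀ n → coeff p n ≡ coeff q n

altSum : ∀ {n} → (Fin n → Poly) → Poly
altSum {zero}  f = []
altSum {suc n} f = subP (f zero) (altSum (λ j → f (suc j)))

det : ∀ {n} → (Fin n → Fin n → Poly) → Poly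
det {zero}  M = constP (+ 1)
det {suc n} M =
  altSum (λ j → mulP (M zero j) (det (λ r c → M (suc r) (punchIn j c))))

charPoly : ∀ {n} → (Fin n → Fin n → ℤ) → Poly
charPoly {n} A = det (λ r c → subP (diag r c) (constP (A r c)))
  where
  diag : Fin n → Fin n → Poly
  diag r c = if toℕ r ℕ.≡ᵇ toℕ c then X else []

-- binary sequence from blocks (bit, multiplicity):  0^{a1} 1^{a2} ...
blocks : List (Bool × ℕ) → List Bool
blocks []             = []
blocks ((b , a) ∷ bs) = replicate a b ++ blocks bs

-- adjacency matrix of the threshold graph with binary sequence bs:
-- for k < j, v_k ~ v_j iff b_j = 1; no loops.
thresholdAdj : (bs : List Bool) → Fin (length bs) → Fin (length bs) → ℤ
thresholdAdj bs k j =
  if toℕ k <ᵇ toℕ j then bit (lookup bs j)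
  else if toℕ j <ᵇ toℕ k then bit (lookup bs k)
  else + 0
  where
  bit : Bool → ℤ
  bit true  = + 1
  bit false = + 0

G'seq : ℕ → List Bool
G'seq i = blocks ( (false , 2 ℕ.* i ℕ.+ 2)
                 ∷ (true  , 3 ℕ.* i)
                 ∷ (false , 2 ℕ.* i ℕ.+ 1)
                 ∷ (true  , 2 ℕ.* i ℕ.+ 2) ∷ [])

ι : ℕ → ℤ
ι n = + n

G'rhs : ℕ → Poly
G'rhs i =
  mulP (powP X (4 ℕ.* i ℕ.+ 1))
  (mulP (powP (addP X (constP (+ 1))) (5 ℕ.* i))
  (mulP (addP X (constP (ι (2 ℕ.* i ℕ.+ 2))))
        cubic))
  where
  cubic : Poly
  cubic = addP (powP X 3)
          (addP (negP (scaleP (ι (7 ℕ.* i ℕ.+ 2)) (powP X 2)))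
          (addP (negP (scaleP (ι (7 ℕ.* i ℕ.+ 3)) X))
                (constP (ι (12 ℕ.* i ℕ.* i ℕ.* i ℕ.+ 18 ℕ.* i ℕ.* i ℕ.+ 6 ℕ.* i)))))

-- Write D(bs) for det(x·I − A) of the threshold graph with bit sequence bs. Its first two
-- vertices are twins, so subtracting the second column from the first and expanding gives
-- D(b ∷ b′ ∷ bs) = y·(2·D(b′ ∷ bs) − y·D(bs)) with y = x + b′, whatever b is. Hence the pair
-- (D(b ∷ bs), D(bs)) is obtained from (x, 1) by applying (u, v) ↦ (y(2u − yv), u), with y = x
-- plus the bit of the vertex, for every vertex after the first, the last one first. Along a
-- block of m + 1 equal bits this iteration has the closed form
-- y^m·(y·((m+2)u − (m+1)yv), (m+1)u − m·yv). Without its first vertex G' consists of four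
-- blocks, so P_{G'} = x^{4i}(x+1)^{5i}·q for a quintic q in x whose coefficients are
-- polynomials in i, and the stated factorisation of q is a polynomial identity in x and i.

module Submission where

open import Defs
open import Data.Nat using (ℕ; _≤_)
open import Data.Sum using (_⊎_)

open import Algebra.Bundles using (CommutativeRing)
open import Algebra.Structures using (IsCommutativeRing)
open import Data.Bool using (Bool; true; false; if_then_else_)
open import Data.Fin using (Fin; zero; suc; punchIn; toℕ)
open import Data.Integer using (ℤ; +_)
import Data.Integer as ℤ
import Data.Integer.Properties as ℤ
import Data.Integer.Tactic.RingSolver as ℤ-Solver
open import Data.List using (List; []; _∷_; length; lookup; replicate; _++_)
open import Data.Maybe using (Maybe; just; nothing)
import Data.Maybe as Maybe
open import Data.Nat using (zero; suc; _+_; _*_; _≡ᵇ_)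
import Data.Nat.Properties as ℕ
import Data.Nat.Tactic.RingSolver as ℕ-Solver
open import Data.Product using (_×_; _,_; proj₁; proj₂)
open import Data.Sum using (inj₁)
open import Function using (_∘_)
open import Level using (0ℓ)
open import Relation.Binary.PropositionalEquality
import Relation.Binary.Reasoning.Setoid
open import Tactic.RingSolver.Core.AlmostCommutativeRing using (AlmostCommutativeRing; fromCommutativeRing)
import Tactic.RingSolver as Solver

-- Polynomial arithmetic

shift : Poly → Poly
shift p = + 0 ∷ p

coeff-addP : ∀ p q n → coeff (addP p q) n ≡ coeff p n ℤ.+ coeff q n
coeff-addP []      q       n       = sym (ℤ.+-identityˡ _)
coeff-addP (a ∷ p) []      n       = sym (ℤ.+-identityʳ _)
coeff-addP (a ∷ p) (b ∷ q) zero    = refl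
coeff-addP (a ∷ p) (b ∷ q) (suc n) = coeff-addP p q n

coeff-negP : ∀ p n → coeff (negP p) n ≡ ℤ.- coeff p n
coeff-negP []      n       = refl
coeff-negP (a ∷ p) zero    = refl
coeff-negP (a ∷ p) (suc n) = coeff-negP p n

coeff-scaleP : ∀ a p n → coeff (scaleP a p) n ≡ a ℤ.* coeff p n
coeff-scaleP a []      n       = sym (ℤ.*-zeroʳ a)
coeff-scaleP a (b ∷ p) zero    = refl
coeff-scaleP a (b ∷ p) (suc n) = coeff-scaleP a p n

coeff-mulP-∷ : ∀ a p q n →
  coeff (mulP (a ∷ p) q) n ≡ a ℤ.* coeff q n ℤ.+ coeff (shift (mulP p q)) n
coeff-mulP-∷ a p q n =
  trans (coeff-addP (scaleP a q) (shift (mulP p q)) n)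
        (cong (ℤ._+ coeff (shift (mulP p q)) n) (coeff-scaleP a q n))

-- A record rather than _≈P_ itself, so that Agda can infer the two polynomials from a proof.
infix 4 _≈_
record _≈_ (p q : Poly) : Set where
  constructor coeffwise
  field coeff-≡ : p ≈P q
open _≈_ public

≈-refl : ∀ {p} → p ≈ p
≈-refl = coeffwise λ _ → refl

≈-sym : ∀ {p q} → p ≈ q → q ≈ p
≈-sym (coeffwise e) = coeffwise λ n → sym (e n)

≈-trans : ∀ {p q r} → p ≈ q → q ≈ r → p ≈ r
≈-trans (coeffwise e) (coeffwise f) = coeffwise λ n → trans (e n) (f n)

≡⇒≈ : ∀ {p q} → p ≡ q → p ≈ q
≡⇒≈ refl = ≈-refl

addP-cong : ∀ {p p′ q q′} → p ≈ p′ → q ≈ q′ → addP p q ≈ addP p′ q′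
addP-cong {p} {p′} {q} {q′} (coeffwise e) (coeffwise f) = coeffwise λ n →
  trans (coeff-addP p q n) (trans (cong₂ ℤ._+_ (e n) (f n)) (sym (coeff-addP p′ q′ n)))

negP-cong : ∀ {p p′} → p ≈ p′ → negP p ≈ negP p′
negP-cong {p} {p′} (coeffwise e) = coeffwise λ n →
  trans (coeff-negP p n) (trans (cong ℤ.-_ (e n)) (sym (coeff-negP p′ n)))

shift-cong : ∀ {p q} → p ≈ q → shift p ≈ shift q
shift-cong (coeffwise e) = coeffwise λ { zero → refl ; (suc n) → e n }

addP-assoc : ∀ p q r → addP (addP p q) r ≈ addP p (addP q r)
addP-assoc p q r = coeffwise λ n → begin
  coeff (addP (addP p q) r) n             ≡⟨ coeff-addP (addP p q) r n ⟩
  coeff (addP p q) n ℤ.+ coeff r n        ≡⟨ cong (ℤ._+ coeff r n) (coeff-addP p q n) ⟩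
  coeff p n ℤ.+ coeff q n ℤ.+ coeff r n   ≡⟨ ℤ.+-assoc (coeff p n) (coeff q n) (coeff r n) ⟩
  coeff p n ℤ.+ (coeff q n ℤ.+ coeff r n) ≡⟨ cong (λ d → coeff p n ℤ.+ d) (sym (coeff-addP q r n)) ⟩
  coeff p n ℤ.+ coeff (addP q r) n        ≡⟨ sym (coeff-addP p (addP q r) n) ⟩
  coeff (addP p (addP q r)) n             ∎
  where open ≡-Reasoning

addP-comm : ∀ p q → addP p q ≈ addP q p
addP-comm p q = coeffwise λ n →
  trans (coeff-addP p q n) (trans (ℤ.+-comm (coeff p n) (coeff q n)) (sym (coeff-addP q p n)))

addP-identityʳ : ∀ p → addP p [] ≈ p
addP-identityʳ p = coeffwise λ n → trans (coeff-addP p [] n) (ℤ.+-identityʳ (coeff p n))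

addP-inverseʳ : ∀ p → addP p (negP p) ≈ []
addP-inverseʳ p = coeffwise λ n →
  trans (coeff-addP p (negP p) n)
        (trans (cong (λ d → coeff p n ℤ.+ d) (coeff-negP p n)) (ℤ.+-inverseʳ (coeff p n)))

mulP-zeroˡ : ∀ p q → p ≈ [] → mulP p q ≈ []
mulP-zeroˡ []      q e             = ≈-refl
mulP-zeroˡ (a ∷ p) q (coeffwise e) = coeffwise λ n → trans (coeff-mulP-∷ a p q n) (vanish n)
  where
  vanish : ∀ n → a ℤ.* coeff q n ℤ.+ coeff (shift (mulP p q)) n ≡ + 0
  vanish zero    = cong (λ c → c ℤ.* coeff q 0 ℤ.+ + 0) (e 0)
  vanish (suc n) = cong₂ (λ c d → c ℤ.* coeff q (suc n) ℤ.+ d) (e 0)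
                         (coeff-≡ (mulP-zeroˡ p q (coeffwise (e ∘ suc))) n)

mulP-congˡ : ∀ {p p′} q → p ≈ p′ → mulP p q ≈ mulP p′ q
mulP-congˡ {[]}    {[]}     q e             = ≈-refl
mulP-congˡ {[]}    {b ∷ p′} q e             = ≈-sym (mulP-zeroˡ (b ∷ p′) q (≈-sym e))
mulP-congˡ {a ∷ p} {[]}     q e             = mulP-zeroˡ (a ∷ p) q e
mulP-congˡ {a ∷ p} {b ∷ p′} q (coeffwise e) =
  addP-cong (≡⇒≈ (cong (λ c → scaleP c q) (e 0)))
            (shift-cong (mulP-congˡ {p} {p′} q (coeffwise (e ∘ suc))))

mulP-distribˡ : ∀ p q r → mulP p (addP q r) ≈ addP (mulP p q) (mulP p r)
mulP-distribˡ []      q r = ≈-refl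
mulP-distribˡ (a ∷ p) q r = coeffwise λ n → begin
  coeff (mulP (a ∷ p) (addP q r)) n
    ≡⟨ coeff-mulP-∷ a p (addP q r) n ⟩
  a ℤ.* coeff (addP q r) n ℤ.+ coeff (shift (mulP p (addP q r))) n
    ≡⟨ cong₂ (λ c d → a ℤ.* c ℤ.+ d) (coeff-addP q r n)
             (trans (coeff-≡ (shift-cong (mulP-distribˡ p q r)) n)
                    (coeff-addP (shift (mulP p q)) (shift (mulP p r)) n)) ⟩
  a ℤ.* (coeff q n ℤ.+ coeff r n) ℤ.+ (coeff (shift (mulP p q)) n ℤ.+ coeff (shift (mulP p r)) n)
    ≡⟨ regroup a (coeff q n) (coeff r n) _ _ ⟩
  (a ℤ.* coeff q n ℤ.+ coeff (shift (mulP p q)) n) ℤ.+ (a ℤ.* coeff r n ℤ.+ coeff (shift (mulP p r)) n)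
    ≡⟨ sym (cong₂ ℤ._+_ (coeff-mulP-∷ a p q n) (coeff-mulP-∷ a p r n)) ⟩
  coeff (mulP (a ∷ p) q) n ℤ.+ coeff (mulP (a ∷ p) r) n
    ≡⟨ sym (coeff-addP (mulP (a ∷ p) q) (mulP (a ∷ p) r) n) ⟩
  coeff (addP (mulP (a ∷ p) q) (mulP (a ∷ p) r)) n ∎
  where
  open ≡-Reasoning
  regroup : ∀ a x y u v → a ℤ.* (x ℤ.+ y) ℤ.+ (u ℤ.+ v) ≡ (a ℤ.* x ℤ.+ u) ℤ.+ (a ℤ.* y ℤ.+ v)
  regroup = ℤ-Solver.solve-∀

mulP-[]ʳ : ∀ p → mulP p [] ≈ []
mulP-[]ʳ []      = ≈-refl
mulP-[]ʳ (a ∷ p) = coeffwise λ { zero → refl ; (suc n) → coeff-≡ (mulP-[]ʳ p) n }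

mulP-∷ʳ : ∀ p b q → mulP p (b ∷ q) ≈ addP (scaleP b p) (shift (mulP p q))
mulP-∷ʳ []      b q = coeffwise λ { zero → refl ; (suc n) → refl }
mulP-∷ʳ (a ∷ p) b q = coeffwise λ
  { zero    → trans (ℤ.+-identityʳ (a ℤ.* b)) (trans (ℤ.*-comm a b) (sym (ℤ.+-identityʳ (b ℤ.* a))))
  ; (suc n) → begin
      coeff (mulP (a ∷ p) (b ∷ q)) (suc n)
        ≡⟨ coeff-mulP-∷ a p (b ∷ q) (suc n) ⟩
      a ℤ.* coeff q n ℤ.+ coeff (mulP p (b ∷ q)) n
        ≡⟨ cong (λ d → a ℤ.* coeff q n ℤ.+ d) (trans (coeff-≡ (mulP-∷ʳ p b q) n)
                                              (coeff-addP (scaleP b p) (shift (mulP p q)) n)) ⟩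
      a ℤ.* coeff q n ℤ.+ (coeff (scaleP b p) n ℤ.+ coeff (shift (mulP p q)) n)
        ≡⟨ swap (a ℤ.* coeff q n) (coeff (scaleP b p) n) _ ⟩
      coeff (scaleP b p) n ℤ.+ (a ℤ.* coeff q n ℤ.+ coeff (shift (mulP p q)) n)
        ≡⟨ cong (λ d → coeff (scaleP b p) n ℤ.+ d) (sym (coeff-mulP-∷ a p q n)) ⟩
      coeff (scaleP b p) n ℤ.+ coeff (mulP (a ∷ p) q) n
        ≡⟨ sym (coeff-addP (scaleP b p) (mulP (a ∷ p) q) n) ⟩
      coeff (addP (scaleP b p) (mulP (a ∷ p) q)) n ∎ }
  where
  open ≡-Reasoning
  swap : ∀ x y z → x ℤ.+ (y ℤ.+ z) ≡ y ℤ.+ (x ℤ.+ z)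
  swap = ℤ-Solver.solve-∀

mulP-comm : ∀ p q → mulP p q ≈ mulP q p
mulP-comm []      q = ≈-sym (mulP-[]ʳ q)
mulP-comm (a ∷ p) q =
  ≈-trans (addP-cong ≈-refl (shift-cong (mulP-comm p q))) (≈-sym (mulP-∷ʳ q a p))

mulP-congʳ : ∀ p {q q′} → q ≈ q′ → mulP p q ≈ mulP p q′
mulP-congʳ p {q} {q′} e = ≈-trans (mulP-comm p q) (≈-trans (mulP-congˡ p e) (mulP-comm q′ p))

mulP-distribʳ : ∀ p q r → mulP (addP p q) r ≈ addP (mulP p r) (mulP q r)
mulP-distribʳ p q r =
  ≈-trans (mulP-comm (addP p q) r)
  (≈-trans (mulP-distribˡ r p q) (addP-cong (mulP-comm r p) (mulP-comm r q)))

mulP-scaleˡ : ∀ a q r → mulP (scaleP a q) r ≈ scaleP a (mulP q r)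
mulP-scaleˡ a []      r = ≈-refl
mulP-scaleˡ a (b ∷ q) r = coeffwise λ n → begin
  coeff (mulP (a ℤ.* b ∷ scaleP a q) r) n
    ≡⟨ coeff-mulP-∷ (a ℤ.* b) (scaleP a q) r n ⟩
  a ℤ.* b ℤ.* coeff r n ℤ.+ coeff (shift (mulP (scaleP a q) r)) n
    ≡⟨ cong (λ d → a ℤ.* b ℤ.* coeff r n ℤ.+ d)
            (trans (coeff-≡ (shift-cong (mulP-scaleˡ a q r)) n) (coeff-shift-scaleP n)) ⟩
  a ℤ.* b ℤ.* coeff r n ℤ.+ a ℤ.* coeff (shift (mulP q r)) n
    ≡⟨ factor a b (coeff r n) _ ⟩
  a ℤ.* (b ℤ.* coeff r n ℤ.+ coeff (shift (mulP q r)) n)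
    ≡⟨ cong (a ℤ.*_) (sym (coeff-mulP-∷ b q r n)) ⟩
  a ℤ.* coeff (mulP (b ∷ q) r) n
    ≡⟨ sym (coeff-scaleP a (mulP (b ∷ q) r) n) ⟩
  coeff (scaleP a (mulP (b ∷ q) r)) n ∎
  where
  open ≡-Reasoning
  factor : ∀ a b x y → a ℤ.* b ℤ.* x ℤ.+ a ℤ.* y ≡ a ℤ.* (b ℤ.* x ℤ.+ y)
  factor = ℤ-Solver.solve-∀
  coeff-shift-scaleP : ∀ n → coeff (shift (scaleP a (mulP q r))) n ≡ a ℤ.* coeff (shift (mulP q r)) n
  coeff-shift-scaleP zero    = sym (ℤ.*-zeroʳ a)
  coeff-shift-scaleP (suc n) = coeff-scaleP a (mulP q r) n

mulP-shiftˡ : ∀ p q → mulP (shift p) q ≈ shift (mulP p q)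
mulP-shiftˡ p q = coeffwise λ n → trans (coeff-mulP-∷ (+ 0) p q n) (ℤ.+-identityˡ _)

mulP-assoc : ∀ p q r → mulP (mulP p q) r ≈ mulP p (mulP q r)
mulP-assoc []      q r = ≈-refl
mulP-assoc (a ∷ p) q r =
  ≈-trans (mulP-distribʳ (scaleP a q) (shift (mulP p q)) r)
  (addP-cong (mulP-scaleˡ a q r)
             (≈-trans (mulP-shiftˡ (mulP p q) r) (shift-cong (mulP-assoc p q r))))

mulP-constP : ∀ a q → mulP (constP a) q ≈ scaleP a q
mulP-constP a q = ≈-trans (addP-cong (≈-refl {scaleP a q}) shift-[]) (addP-identityʳ (scaleP a q))
  where
  shift-[] : shift [] ≈ []
  shift-[] = coeffwise λ { zero → refl ; (suc n) → refl }

mulP-identityˡ : ∀ q → mulP (constP (+ 1)) q ≈ q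
mulP-identityˡ q =
  ≈-trans (mulP-constP (+ 1) q) (coeffwise λ n → trans (coeff-scaleP (+ 1) q n) (ℤ.*-identityˡ (coeff q n)))

ℤ[X]-isCommutativeRing : IsCommutativeRing _≈_ addP mulP negP [] (constP (+ 1))
ℤ[X]-isCommutativeRing = record
  { isRing = record
    { +-isAbelianGroup = record
      { isGroup = record
        { isMonoid = record
          { isSemigroup = record
            { isMagma = record
              { isEquivalence = record { refl = ≈-refl ; sym = ≈-sym ; trans = ≈-trans }
              ; ∙-cong        = addP-cong }
            ; assoc = addP-assoc }
          ; identity = (λ p → ≈-refl) , addP-identityʳ }
        ; inverse = (λ p → ≈-trans (addP-comm (negP p) p) (addP-inverseʳ p)) , addP-inverseʳ
        ; ⁻¹-cong = negP-cong }
      ; comm = addP-comm }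
    ; *-cong     = λ {p} {p′} {q} {q′} e f → ≈-trans (mulP-congˡ q e) (mulP-congʳ p′ f)
    ; *-assoc    = mulP-assoc
    ; *-identity = mulP-identityˡ , λ q → ≈-trans (mulP-comm q (constP (+ 1))) (mulP-identityˡ q)
    ; distrib    = mulP-distribˡ , λ r p q → mulP-distribʳ p q r }
  ; *-comm = mulP-comm }

ℤ[X]-commutativeRing : CommutativeRing 0ℓ 0ℓ
ℤ[X]-commutativeRing = record { isCommutativeRing = ℤ[X]-isCommutativeRing }

ℤ[X] : AlmostCommutativeRing 0ℓ 0ℓ
ℤ[X] = fromCommutativeRing ℤ[X]-commutativeRing (Maybe.map ≈-sym ∘ vanishes?)
  where
  vanishes? : ∀ p → Maybe (p ≈ [])
  vanishes? []           = just ≈-refl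
  vanishes? (+ zero ∷ p) =
    Maybe.map (λ e → coeffwise λ { zero → refl ; (suc n) → coeff-≡ e n }) (vanishes? p)
  vanishes? (_ ∷ p)      = nothing

open AlmostCommutativeRing ℤ[X] using (0#; 1#)
  renaming (_+_ to infixl 6 _⊕_; _*_ to infixl 7 _⊗_; _-_ to infixl 6 _⊝_; -_ to ⊖_)

open CommutativeRing ℤ[X]-commutativeRing
  using (+-cong; *-cong; -‿cong; +-identityʳ; -‿inverseʳ; *-identityˡ; *-identityʳ; *-assoc;
         zeroˡ; zeroʳ; distribˡ; distribʳ)

module ≈-Reasoning = Relation.Binary.Reasoning.Setoid (CommutativeRing.setoid ℤ[X]-commutativeRing)

⊕-congˡ : ∀ a {p q} → p ≈ q → a ⊕ p ≈ a ⊕ q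
⊕-congˡ a = +-cong (≈-refl {a})

⊗-congˡ : ∀ a {p q} → p ≈ q → a ⊗ p ≈ a ⊗ q
⊗-congˡ a = *-cong (≈-refl {a})

⊗-congʳ : ∀ a {p q} → p ≈ q → p ⊗ a ≈ q ⊗ a
⊗-congʳ a e = *-cong e (≈-refl {a})

ν : ℕ → Poly
ν n = constP (+ n)

ν-zero : ν 0 ≈ 0#
ν-zero = coeffwise λ { zero → refl ; (suc n) → refl }

ν-+ : ∀ m n → ν (m + n) ≈ ν m ⊕ ν n
ν-+ m n = coeffwise λ { zero → refl ; (suc k) → refl }

ν-* : ∀ m n → ν (m * n) ≈ ν m ⊗ ν n
ν-* m n = coeffwise λ { zero → trans (ℤ.pos-* m n) (sym (ℤ.+-identityʳ _)) ; (suc k) → refl }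

ν-suc : ∀ m → ν (suc m) ≈ ν m ⊕ 1#
ν-suc m = ≈-trans (≡⇒≈ (cong ν (ℕ.+-comm 1 m))) (ν-+ m 1)

ν-linear : ∀ a b n → ν (a * n + b) ≈ ν a ⊗ ν n ⊕ ν b
ν-linear a b n = ≈-trans (ν-+ (a * n) b) (+-cong (ν-* a n) (≈-refl {ν b}))

powP-+ : ∀ p m n → powP p (m + n) ≈ powP p m ⊗ powP p n
powP-+ p zero    n = ≈-sym (*-identityˡ (powP p n))
powP-+ p (suc m) n = ≈-trans (⊗-congˡ p (powP-+ p m n)) (≈-sym (*-assoc p (powP p m) (powP p n)))

-- Determinants

Matrix : ℕ → Set
Matrix n = Fin n → Fin n → Poly

minor : ∀ {n} → Matrix (suc n) → Fin (suc n) → Matrix n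
minor M j r c = M (suc r) (punchIn j c)

minor₁₀ : ∀ {n} → Matrix (suc (suc n)) → Matrix (suc n)
minor₁₀ M zero    c = M zero (suc c)
minor₁₀ M (suc r) c = M (suc (suc r)) (suc c)

altSum-cong : ∀ {n} {f g : Fin n → Poly} → (∀ j → f j ≈ g j) → altSum f ≈ altSum g
altSum-cong {zero}  e = ≈-refl
altSum-cong {suc n} e = +-cong (e zero) (-‿cong (altSum-cong (e ∘ suc)))

altSum-vanishes : ∀ {n} (f : Fin n → Poly) → (∀ j → f j ≈ 0#) → altSum f ≈ 0#
altSum-vanishes {zero}  f e = ≈-refl
altSum-vanishes {suc n} f e = +-cong (e zero) (-‿cong (altSum-vanishes (f ∘ suc) (e ∘ suc)))

altSum-+ : ∀ {n} (f g : Fin n → Poly) → altSum (λ j → f j ⊕ g j) ≈ altSum f ⊕ altSum g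
altSum-+ {zero}  f g = ≈-refl
altSum-+ {suc n} f g =
  ≈-trans (⊕-congˡ (f zero ⊕ g zero) (-‿cong (altSum-+ (f ∘ suc) (g ∘ suc))))
          (interchange (f zero) (g zero) (altSum (f ∘ suc)) (altSum (g ∘ suc)))
  where
  interchange : ∀ a b c d → (a ⊕ b) ⊝ (c ⊕ d) ≈ (a ⊝ c) ⊕ (b ⊝ d)
  interchange = Solver.solve-∀ ℤ[X]

altSum-* : ∀ {n} s (f : Fin n → Poly) → altSum (λ j → s ⊗ f j) ≈ s ⊗ altSum f
altSum-* {zero}  s f = ≈-sym (zeroʳ s)
altSum-* {suc n} s f =
  ≈-trans (⊕-congˡ (s ⊗ f zero) (-‿cong (altSum-* s (f ∘ suc))))
          (factor s (f zero) (altSum (f ∘ suc)))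
  where
  factor : ∀ s a b → s ⊗ a ⊝ s ⊗ b ≈ s ⊗ (a ⊝ b)
  factor = Solver.solve-∀ ℤ[X]

det-cong : ∀ {n} {M N : Matrix n} → (∀ r c → M r c ≈ N r c) → det M ≈ det N
det-cong {zero}  e = ≈-refl
det-cong {suc n} e = altSum-cong λ j → *-cong (e zero j) (det-cong λ r c → e (suc r) (punchIn j c))

det-column-one-entry : ∀ {n} (M : Matrix (suc n)) → (∀ r → M (suc r) zero ≈ 0#) →
  det M ≈ M zero zero ⊗ det (minor M zero)
det-zero-column : ∀ {n} (M : Matrix (suc n)) → (∀ r → M r zero ≈ 0#) → det M ≈ 0#

det-column-one-entry {zero}  M h = +-identityʳ (M zero zero ⊗ 1#)
det-column-one-entry {suc n} M h =
  ≈-trans (⊕-congˡ (M zero zero ⊗ det (minor M zero)) (-‿cong (altSum-vanishes later-term vanish)))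
          (+-identityʳ (M zero zero ⊗ det (minor M zero)))
  where
  later-term : Fin (suc n) → Poly
  later-term k = M zero (suc k) ⊗ det (minor M (suc k))
  vanish : ∀ k → later-term k ≈ 0#
  vanish k = ≈-trans (⊗-congˡ (M zero (suc k)) (det-zero-column (minor M (suc k)) h)) (zeroʳ (M zero (suc k)))

det-zero-column M h =
  ≈-trans (det-column-one-entry M (h ∘ suc))
          (≈-trans (⊗-congʳ (det (minor M zero)) (h zero)) (zeroˡ (det (minor M zero))))

det-equal-columns : ∀ {n} (M : Matrix (suc (suc n))) → (∀ r → M r zero ≈ M r (suc zero)) → det M ≈ 0#
det-equal-columns {n} M h =
  ≈-trans (+-cong leading-terms (-‿cong (⊕-congˡ (term (suc zero)) (-‿cong (later-terms n M h)))))
          (cancel (term (suc zero)))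
  where
  term : Fin (suc (suc n)) → Poly
  term j = M zero j ⊗ det (minor M j)
  minors-agree : ∀ r c → minor M zero r c ≈ minor M (suc zero) r c
  minors-agree r zero    = ≈-sym (h (suc r))
  minors-agree r (suc c) = ≈-refl
  leading-terms : term zero ≈ term (suc zero)
  leading-terms = *-cong (h zero) (det-cong minors-agree)
  later-terms : ∀ n (M : Matrix (suc (suc n))) → (∀ r → M r zero ≈ M r (suc zero)) →
                altSum (λ k → M zero (suc (suc k)) ⊗ det (minor M (suc (suc k)))) ≈ 0#
  later-terms zero    M h = ≈-refl
  later-terms (suc n) M h = altSum-vanishes (λ k → M zero (suc (suc k)) ⊗ det (minor M (suc (suc k)))) λ k →
    ≈-trans (⊗-congˡ (M zero (suc (suc k))) (det-equal-columns (minor M (suc (suc k))) (h ∘ suc)))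
            (zeroʳ (M zero (suc (suc k))))
  cancel : ∀ a → a ⊝ (a ⊝ 0#) ≈ 0#
  cancel = Solver.solve-∀ ℤ[X]

det-additive-column : ∀ {n} (A B C : Matrix (suc n)) →
  (∀ r → C r zero ≈ A r zero ⊕ B r zero) →
  (∀ r c → A r (suc c) ≈ C r (suc c)) → (∀ r c → B r (suc c) ≈ C r (suc c)) →
  det C ≈ det A ⊕ det B
det-additive-column A B C h₀ hA hB =
  ≈-trans (altSum-cong (term A B C h₀ hA hB))
          (altSum-+ (λ j → A zero j ⊗ det (minor A j)) (λ j → B zero j ⊗ det (minor B j)))
  where
  term : ∀ {n} (A B C : Matrix (suc n)) →
    (∀ r → C r zero ≈ A r zero ⊕ B r zero) →
    (∀ r c → A r (suc c) ≈ C r (suc c)) → (∀ r c → B r (suc c) ≈ C r (suc c)) →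
    ∀ j → C zero j ⊗ det (minor C j) ≈ A zero j ⊗ det (minor A j) ⊕ B zero j ⊗ det (minor B j)
  term A B C h₀ hA hB zero =
    ≈-trans (⊗-congʳ (det (minor C zero)) (h₀ zero))
    (≈-trans (distribʳ (det (minor C zero)) (A zero zero) (B zero zero))
    (+-cong (⊗-congˡ (A zero zero) (det-cong λ r c → ≈-sym (hA (suc r) c)))
            (⊗-congˡ (B zero zero) (det-cong λ r c → ≈-sym (hB (suc r) c)))))
  term {suc n} A B C h₀ hA hB (suc k) =
    ≈-trans (⊗-congˡ (C zero (suc k))
              (det-additive-column (minor A (suc k)) (minor B (suc k)) (minor C (suc k))
                (h₀ ∘ suc) (λ r c → hA (suc r) (punchIn k c)) (λ r c → hB (suc r) (punchIn k c))))
    (≈-trans (distribˡ (C zero (suc k)) (det (minor A (suc k))) (det (minor B (suc k))))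
    (+-cong (⊗-congʳ (det (minor A (suc k))) (≈-sym (hA zero k)))
            (⊗-congʳ (det (minor B (suc k))) (≈-sym (hB zero k)))))

det-column-two-entries : ∀ {n} (M : Matrix (suc (suc n))) → (∀ r → M (suc (suc r)) zero ≈ 0#) →
  det M ≈ M zero zero ⊗ det (minor M zero) ⊝ M (suc zero) zero ⊗ det (minor₁₀ M)
det-column-two-entries M h =
  ⊕-congˡ (M zero zero ⊗ det (minor M zero)) (-‿cong
    (≈-trans (altSum-cong term)
             (altSum-* (M (suc zero) zero) λ k → minor₁₀ M zero k ⊗ det (minor (minor₁₀ M) k))))
  where
  term : ∀ k → M zero (suc k) ⊗ det (minor M (suc k))
             ≈ M (suc zero) zero ⊗ (minor₁₀ M zero k ⊗ det (minor (minor₁₀ M) k))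
  term k = ≈-trans (⊗-congˡ (M zero (suc k)) (det-column-one-entry (minor M (suc k)) h))
                   (swap (M zero (suc k)) (M (suc zero) zero) (det (minor (minor₁₀ M) k)))
    where
    swap : ∀ a b d → a ⊗ (b ⊗ d) ≈ b ⊗ (a ⊗ d)
    swap = Solver.solve-∀ ℤ[X]

det-corner-difference : ∀ {n} (A B : Matrix (suc n)) →
  (∀ c → A zero (suc c) ≈ B zero (suc c)) → (∀ r c → A (suc r) c ≈ B (suc r) c) →
  det A ≈ det B ⊕ (A zero zero ⊝ B zero zero) ⊗ det (minor A zero)
det-corner-difference A B h₀ h = begin
  det A
    ≈⟨ ⊕-congˡ (A zero zero ⊗ det (minor A zero)) (-‿cong (altSum-cong λ k →
         *-cong (h₀ k) (det-cong λ r c → h r (punchIn (suc k) c)))) ⟩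
  A zero zero ⊗ det (minor A zero) ⊝ tail
    ≈⟨ split (A zero zero) (B zero zero) (det (minor A zero)) tail ⟩
  (B zero zero ⊗ det (minor A zero) ⊝ tail) ⊕ (A zero zero ⊝ B zero zero) ⊗ det (minor A zero)
    ≈⟨ +-cong (+-cong (⊗-congˡ (B zero zero) (det-cong λ r c → h r (suc c))) ≈-refl) ≈-refl ⟩
  det B ⊕ (A zero zero ⊝ B zero zero) ⊗ det (minor A zero) ∎
  where
  open ≈-Reasoning
  tail : Poly
  tail = altSum λ k → B zero (suc k) ⊗ det (minor B (suc k))
  split : ∀ a b d t → a ⊗ d ⊝ t ≈ (b ⊗ d ⊝ t) ⊕ (a ⊝ b) ⊗ d
  split = Solver.solve-∀ ℤ[X]

-- Subtracting column 1 from column 0 leaves only two entries in column 0, and the minor of the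
-- entry in row 1 differs from the minor of the entry in row 0 only in its corner.
det-twins : ∀ {n} (M : Matrix (suc (suc n))) →
  (∀ r → M (suc (suc r)) zero ≈ M (suc (suc r)) (suc zero)) →
  (∀ c → M zero (suc (suc c)) ≈ M (suc zero) (suc (suc c))) →
  M (suc zero) (suc zero) ≈ M zero zero → M (suc zero) zero ≈ M zero (suc zero) →
  let a  = M zero zero ⊝ M zero (suc zero)
      d₁ = det (minor M zero)
      d₂ = det (minor (minor M zero) zero)
  in det M ≈ a ⊗ (d₁ ⊕ d₁ ⊝ a ⊗ d₂)
det-twins {n} M h-rows h-row₀ h-diag h-sym = begin
  det M
    ≈⟨ det-additive-column N E M (λ r → split (M r zero) (M r (suc zero)))
                                 (λ r c → ≈-refl) (λ r c → ≈-refl) ⟩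
  det N ⊕ det E
    ≈⟨ +-cong (det-column-two-entries N λ r →
                 ≈-trans (+-cong (h-rows r) ≈-refl) (-‿inverseʳ (M (suc (suc r)) (suc zero))))
              (det-equal-columns E λ r → ≈-refl) ⟩
  (m₀₀ ⊝ m₀₁) ⊗ d₁ ⊝ (M (suc zero) zero ⊝ M (suc zero) (suc zero)) ⊗ det (minor₁₀ N) ⊕ 0#
    ≈⟨ +-cong (⊕-congˡ ((m₀₀ ⊝ m₀₁) ⊗ d₁)
                       (-‿cong (*-cong (+-cong h-sym (-‿cong h-diag)) det-minor₁₀)))
              ≈-refl ⟩
  (m₀₀ ⊝ m₀₁) ⊗ d₁ ⊝ (m₀₁ ⊝ m₀₀) ⊗ (d₁ ⊕ (m₀₁ ⊝ m₀₀) ⊗ d₂) ⊕ 0#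
    ≈⟨ collect m₀₀ m₀₁ d₁ d₂ ⟩
  (m₀₀ ⊝ m₀₁) ⊗ (d₁ ⊕ d₁ ⊝ (m₀₀ ⊝ m₀₁) ⊗ d₂) ∎
  where
  open ≈-Reasoning
  m₀₀ m₀₁ d₁ d₂ : Poly
  m₀₀ = M zero zero
  m₀₁ = M zero (suc zero)
  d₁  = det (minor M zero)
  d₂  = det (minor (minor M zero) zero)
  N E : Matrix (suc (suc n))
  N r zero    = M r zero ⊝ M r (suc zero)
  N r (suc c) = M r (suc c)
  E r zero    = M r (suc zero)
  E r (suc c) = M r (suc c)
  det-minor₁₀ : det (minor₁₀ N) ≈ d₁ ⊕ (m₀₁ ⊝ m₀₀) ⊗ d₂
  det-minor₁₀ = ≈-trans (det-corner-difference (minor₁₀ N) (minor M zero) h-row₀ (λ r c → ≈-refl))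
                        (⊕-congˡ d₁ (⊗-congʳ d₂ (⊕-congˡ m₀₁ (-‿cong h-diag))))
  split : ∀ a b → a ≈ (a ⊝ b) ⊕ b
  split = Solver.solve-∀ ℤ[X]
  collect : ∀ a b d₁ d₂ →
    (a ⊝ b) ⊗ d₁ ⊝ (b ⊝ a) ⊗ (d₁ ⊕ (b ⊝ a) ⊗ d₂) ⊕ 0# ≈ (a ⊝ b) ⊗ (d₁ ⊕ d₁ ⊝ (a ⊝ b) ⊗ d₂)
  collect = Solver.solve-∀ ℤ[X]

-- Threshold graphs

bit : Bool → ℤ
bit true  = + 1
bit false = + 0

-- x·I − A, arranged so that deleting the first row and column gives, definitionally, the
-- matrix of the remaining vertices.
thresholdCharMatrix : (bs : List Bool) → Matrix (length bs)
thresholdCharMatrix (b ∷ bs) zero    zero    = X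
thresholdCharMatrix (b ∷ bs) zero    (suc c) = ⊖ constP (bit (lookup bs c))
thresholdCharMatrix (b ∷ bs) (suc r) zero    = ⊖ constP (bit (lookup bs r))
thresholdCharMatrix (b ∷ bs) (suc r) (suc c) = thresholdCharMatrix bs r c

charPoly-threshold : ∀ bs → charPoly (thresholdAdj bs) ≈ det (thresholdCharMatrix bs)
charPoly-threshold bs = det-cong λ r c → ≡⇒≈ (entry bs r c)
  where
  entry : ∀ bs r c → subP (if toℕ r ≡ᵇ toℕ c then X else []) (constP (thresholdAdj bs r c))
                     ≡ thresholdCharMatrix bs r c
  entry (b ∷ bs) zero    zero    = refl
  entry (b ∷ bs) zero    (suc c) with lookup bs c
  ... | true  = refl
  ... | false = refl
  entry (b ∷ bs) (suc r) zero    with lookup bs r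
  ... | true  = refl
  ... | false = refl
  entry (b ∷ bs) (suc r) (suc c) = entry bs r c

weight : Bool → Poly
weight b = X ⊕ constP (bit b)

det-threshold-recurrence : ∀ b b′ bs →
  let d₁ = det (thresholdCharMatrix (b′ ∷ bs))
      d₂ = det (thresholdCharMatrix bs)
  in det (thresholdCharMatrix (b ∷ b′ ∷ bs)) ≈ weight b′ ⊗ (d₁ ⊕ d₁ ⊝ weight b′ ⊗ d₂)
det-threshold-recurrence b b′ bs =
  ≈-trans (det-twins (thresholdCharMatrix (b ∷ b′ ∷ bs)) (λ r → ≈-refl) (λ c → ≈-refl) ≈-refl ≈-refl)
          (*-cong x+b′ (⊕-congˡ (d₁ ⊕ d₁) (-‿cong (⊗-congʳ d₂ x+b′))))
  where
  d₁ d₂ : Poly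
  d₁ = det (thresholdCharMatrix (b′ ∷ bs))
  d₂ = det (thresholdCharMatrix bs)
  x+b′ : X ⊝ ⊖ constP (bit b′) ≈ weight b′
  x+b′ = minus-negation X (constP (bit b′))
    where
    minus-negation : ∀ x w → x ⊝ ⊖ w ≈ x ⊕ w
    minus-negation = Solver.solve-∀ ℤ[X]

infix 4 _≈²_
record _≈²_ (p q : Poly × Poly) : Set where
  constructor _,_
  field
    fst : proj₁ p ≈ proj₁ q
    snd : proj₂ p ≈ proj₂ q

≈²-trans : ∀ {p q r} → p ≈² q → q ≈² r → p ≈² r
≈²-trans (e₁ , e₂) (f₁ , f₂) = ≈-trans e₁ f₁ , ≈-trans e₂ f₂

step : Poly → Poly × Poly → Poly × Poly
step y (u , v) = y ⊗ (u ⊕ u ⊝ y ⊗ v) , u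

step-cong : ∀ y {p q} → p ≈² q → step y p ≈² step y q
step-cong y (e₁ , e₂) = ⊗-congˡ y (+-cong (+-cong e₁ e₁) (-‿cong (⊗-congˡ y e₂))) , e₁

detPair : List Bool → Poly × Poly
detPair []       = X , 1#
detPair (b ∷ bs) = step (weight b) (detPair bs)

det-threshold≈detPair : ∀ b bs →
  (det (thresholdCharMatrix (b ∷ bs)) , det (thresholdCharMatrix bs)) ≈² detPair bs
det-threshold≈detPair b []        = ≈-trans (+-identityʳ (X ⊗ 1#)) (*-identityʳ X) , ≈-refl
det-threshold≈detPair b (b′ ∷ bs) with det-threshold≈detPair b′ bs
... | ih@(d₁≈ , _) = ≈-trans (det-threshold-recurrence b b′ bs) (_≈²_.fst (step-cong (weight b′) ih)) , d₁≈

transfer : Poly → Poly → Poly → Poly → Poly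
transfer c y u v = (c ⊕ 1#) ⊗ u ⊝ (c ⊗ y) ⊗ v
{-# INLINE transfer #-}

transferPair : Poly → Poly → Poly × Poly → Poly × Poly
transferPair c y (u , v) = y ⊗ transfer (c ⊕ 1#) y u v , transfer c y u v

transferPair-cong : ∀ {c c′} y p → c ≈ c′ → transferPair c y p ≈² transferPair c′ y p
transferPair-cong y (u , v) e = ⊗-congˡ y (transfer-cong (+-cong e ≈-refl)) , transfer-cong e
  where
  transfer-cong : ∀ {c c′} → c ≈ c′ → transfer c y u v ≈ transfer c′ y u v
  transfer-cong e = +-cong (⊗-congʳ u (+-cong e ≈-refl)) (-‿cong (⊗-congʳ v (⊗-congʳ y e)))

infixr 7 _•_
_•_ : Poly → Poly × Poly → Poly × Poly
a • (u , v) = a ⊗ u , a ⊗ v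

•-cong : ∀ {a a′ p p′} → a ≈ a′ → p ≈² p′ → a • p ≈² a′ • p′
•-cong e (f₁ , f₂) = *-cong e f₁ , *-cong e f₂

step-• : ∀ y a q → step y (a • q) ≈² a • transferPair 0# y q
step-• y a (u , v) = first y a u v , second y a u v
  where
  first : ∀ y a u v → y ⊗ (a ⊗ u ⊕ a ⊗ u ⊝ y ⊗ (a ⊗ v)) ≈ a ⊗ (y ⊗ transfer (0# ⊕ 1#) y u v)
  first = Solver.solve-∀ ℤ[X]
  second : ∀ y a u v → a ⊗ u ≈ a ⊗ transfer 0# y u v
  second = Solver.solve-∀ ℤ[X]

step-transferPair : ∀ y a c q →
  step y (a • transferPair c y q) ≈² (y ⊗ a) • transferPair (c ⊕ 1#) y q
step-transferPair y a c (u , v) = first y a c u v , second y a c u v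
  where
  first : ∀ y a c u v →
    let t = y ⊗ transfer (c ⊕ 1#) y u v in
    y ⊗ (a ⊗ t ⊕ a ⊗ t ⊝ y ⊗ (a ⊗ transfer c y u v)) ≈ y ⊗ a ⊗ (y ⊗ transfer (c ⊕ 1# ⊕ 1#) y u v)
  first = Solver.solve-∀ ℤ[X]
  second : ∀ y a c u v → a ⊗ (y ⊗ transfer (c ⊕ 1#) y u v) ≈ y ⊗ a ⊗ transfer (c ⊕ 1#) y u v
  second = Solver.solve-∀ ℤ[X]

detPair-replicate : ∀ m b bs a q {c} → detPair bs ≈² a • q → c ≈ ν m →
  detPair (replicate (suc m) b ++ bs) ≈² (powP (weight b) m ⊗ a) • transferPair c (weight b) q
detPair-replicate m b bs a q e c≈m =
  ≈²-trans (iterate m) (•-cong (≈-refl {powP (weight b) m ⊗ a}) (transferPair-cong (weight b) q (≈-sym c≈m)))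
  where
  y : Poly
  y = weight b
  iterate : ∀ m → detPair (replicate (suc m) b ++ bs) ≈² (powP y m ⊗ a) • transferPair (ν m) y q
  iterate zero =
    ≈²-trans (step-cong y e)
    (≈²-trans (step-• y a q) (•-cong (≈-sym (*-identityˡ a)) (transferPair-cong y q (≈-sym ν-zero))))
  iterate (suc m) =
    ≈²-trans (step-cong y (iterate m))
    (≈²-trans (step-transferPair y (powP y m ⊗ a) (ν m) q)
              (•-cong (≈-sym (*-assoc y (powP y m) a)) (transferPair-cong y q (≈-sym (ν-suc m)))))

-- The graph G'

-- The first component of G'.q₁ below, with x and I abstract; it is spelled out through the
-- inlined transfer because the ring solver does not unfold definitions.
G'-transfers : ∀ x I →
  let Y  = x ⊕ 1#
      c₄ = ν 2 ⊗ I ⊕ 1#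
      u₄ = Y ⊗ transfer (c₄ ⊕ 1#) Y x 1#
      v₄ = transfer c₄ Y x 1#
      c₃ = ν 2 ⊗ I
      u₃ = x ⊗ transfer (c₃ ⊕ 1#) x u₄ v₄
      v₃ = transfer c₃ x u₄ v₄
      c₂ = ν 3 ⊗ I ⊝ 1#
      u₂ = Y ⊗ transfer (c₂ ⊕ 1#) Y u₃ v₃
      v₂ = transfer c₂ Y u₃ v₃
      c₁ = ν 2 ⊗ I
  in x ⊗ transfer (c₁ ⊕ 1#) x u₂ v₂
     ≈ x ⊗ ((x ⊕ (ν 2 ⊗ I ⊕ ν 2)) ⊗ (x ⊗ x ⊗ x ⊕ (⊖ ((ν 7 ⊗ I ⊕ ν 2) ⊗ (x ⊗ x))
                                      ⊕ (⊖ ((ν 7 ⊗ I ⊕ ν 3) ⊗ x)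
                                      ⊕ (ν 12 ⊗ I ⊗ I ⊗ I ⊕ ν 18 ⊗ I ⊗ I ⊕ ν 6 ⊗ I)))))
G'-transfers = Solver.solve-∀ ℤ[X]

module G' (j : ℕ) where

  i : ℕ
  i = suc j

  I Y : Poly
  I = ν i
  Y = X ⊕ 1#

  t₁ t₂ t₃ t₄ : List Bool
  t₄ = replicate (suc (suc (2 * i))) true ++ []
  t₃ = replicate (suc (2 * i)) false ++ t₄
  t₂ = replicate (3 * i) true ++ t₃
  t₁ = replicate (suc (2 * i)) false ++ t₂

  G'seq-∷ : G'seq i ≡ false ∷ t₁
  G'seq-∷ = cong₂ (λ m n → replicate m false ++ (replicate (3 * i) true ++
                              (replicate n false ++ (replicate m true ++ []))))
                  (ℕ.+-comm (2 * i) 2) (ℕ.+-comm (2 * i) 1)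

  q₁ q₂ q₃ q₄ : Poly × Poly
  q₄ = transferPair (ν 2 ⊗ I ⊕ 1#) Y (X , 1#)
  q₃ = transferPair (ν 2 ⊗ I) X q₄
  q₂ = transferPair (ν 3 ⊗ I ⊝ 1#) Y q₃
  q₁ = transferPair (ν 2 ⊗ I) X q₂

  P Q R a₁ a₂ a₃ a₄ : Poly
  P  = powP X (2 * i)
  Q  = powP Y (j + 2 * i)
  R  = powP Y (suc (2 * i))
  a₄ = R ⊗ 1#
  a₃ = P ⊗ a₄
  a₂ = Q ⊗ a₃
  a₁ = P ⊗ a₂

  ν-2i : ν 2 ⊗ I ≈ ν (2 * i)
  ν-2i = ≈-sym (ν-* 2 i)

  ν-3i-1 : ν 3 ⊗ I ⊝ 1# ≈ ν (j + 2 * i)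
  ν-3i-1 = ≈-sym (≈-trans (add-sub (ν (j + 2 * i)))
                          (+-cong (≈-trans (≈-sym (ν-suc (j + 2 * i))) (ν-* 3 i)) (≈-refl {⊖ 1#})))
    where
    add-sub : ∀ a → a ≈ a ⊕ 1# ⊝ 1#
    add-sub = Solver.solve-∀ ℤ[X]

  -- Every argument is explicit: I is the one-element list ν i, so if Agda had to infer the
  -- arguments it would start computing with polynomials in i.
  detPair-t₁ : detPair t₁ ≈² a₁ • q₁
  detPair-t₁ =
    detPair-replicate (2 * i) false t₂ a₂ q₂
      (detPair-replicate (j + 2 * i) true t₃ a₃ q₃
        (detPair-replicate (2 * i) false t₄ a₄ q₄
          (detPair-replicate (suc (2 * i)) true [] 1# (X , 1#)
            (≈-sym (*-identityˡ X) , ≈-sym (*-identityˡ 1#))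
            (≈-trans (+-cong ν-2i (≈-refl {1#})) (≈-sym (ν-suc (2 * i)))))
          ν-2i)
        ν-3i-1)
      ν-2i

  L C : Poly
  L = X ⊕ (ν 2 ⊗ I ⊕ ν 2)
  C = X ⊗ X ⊗ X ⊕ (⊖ ((ν 7 ⊗ I ⊕ ν 2) ⊗ (X ⊗ X))
                ⊕ (⊖ ((ν 7 ⊗ I ⊕ ν 3) ⊗ X)
                ⊕ (ν 12 ⊗ I ⊗ I ⊗ I ⊕ ν 18 ⊗ I ⊗ I ⊕ ν 6 ⊗ I)))

  G'rhs-≈ : G'rhs i ≈ (X ⊗ (P ⊗ P)) ⊗ ((Q ⊗ R) ⊗ (L ⊗ C))
  G'rhs-≈ = *-cong X-power (*-cong Y-power (*-cong (⊕-congˡ X (ν-linear 2 2 i)) cubic))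
    where
    X-power : powP X (4 * i + 1) ≈ X ⊗ (P ⊗ P)
    X-power = ≈-trans (≡⇒≈ (cong (powP X) (exponent j))) (⊗-congˡ X (powP-+ X (2 * i) (2 * i)))
      where
      exponent : ∀ j → 4 * suc j + 1 ≡ suc (2 * suc j + 2 * suc j)
      exponent = ℕ-Solver.solve-∀
    Y-power : powP Y (5 * i) ≈ Q ⊗ R
    Y-power = ≈-trans (≡⇒≈ (cong (powP Y) (exponent j))) (powP-+ Y (j + 2 * i) (suc (2 * i)))
      where
      exponent : ∀ j → 5 * suc j ≡ (j + 2 * suc j) + suc (2 * suc j)
      exponent = ℕ-Solver.solve-∀
    constant-term : ν (12 * i * i * i + 18 * i * i + 6 * i) ≈ ν 12 ⊗ I ⊗ I ⊗ I ⊕ ν 18 ⊗ I ⊗ I ⊕ ν 6 ⊗ I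
    constant-term =
      ≈-trans (ν-+ (12 * i * i * i + 18 * i * i) (6 * i))
      (+-cong (≈-trans (ν-+ (12 * i * i * i) (18 * i * i))
                (+-cong (≈-trans (ν-* (12 * i * i) i)
                                 (⊗-congʳ I (≈-trans (ν-* (12 * i) i) (⊗-congʳ I (ν-* 12 i)))))
                        (≈-trans (ν-* (18 * i) i) (⊗-congʳ I (ν-* 18 i)))))
              (ν-* 6 i))
    cubic : addP (powP X 3) (addP (negP (scaleP (ι (7 * i + 2)) (powP X 2)))
                           (addP (negP (scaleP (ι (7 * i + 3)) X))
                                 (constP (ι (12 * i * i * i + 18 * i * i + 6 * i))))) ≈ C
    cubic =
      ⊕-congˡ (powP X 3)
        (+-cong (-‿cong (≈-trans (≈-sym (mulP-constP (ι (7 * i + 2)) (powP X 2)))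
                                 (⊗-congʳ (powP X 2) (ν-linear 7 2 i))))
        (+-cong (-‿cong (≈-trans (≈-sym (mulP-constP (ι (7 * i + 3)) X)) (⊗-congʳ X (ν-linear 7 3 i))))
                constant-term))

  charPoly-G' : charPoly (thresholdAdj (G'seq i)) ≈ G'rhs i
  charPoly-G' = begin
    charPoly (thresholdAdj (G'seq i))
      ≈⟨ ≡⇒≈ (cong (λ bs → charPoly (thresholdAdj bs)) G'seq-∷) ⟩
    charPoly (thresholdAdj (false ∷ t₁))
      ≈⟨ charPoly-threshold (false ∷ t₁) ⟩
    det (thresholdCharMatrix (false ∷ t₁))
      ≈⟨ _≈²_.fst (≈²-trans (det-threshold≈detPair false t₁) detPair-t₁) ⟩
    a₁ ⊗ proj₁ q₁
      ≈⟨ ⊗-congˡ a₁ (G'-transfers X I) ⟩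
    a₁ ⊗ (X ⊗ (L ⊗ C))
      ≈⟨ rearrange X P Q R (L ⊗ C) ⟩
    (X ⊗ (P ⊗ P)) ⊗ ((Q ⊗ R) ⊗ (L ⊗ C))
      ≈⟨ ≈-sym G'rhs-≈ ⟩
    G'rhs i ∎
    where
    open ≈-Reasoning
    rearrange : ∀ x P Q R F → P ⊗ (Q ⊗ (P ⊗ (R ⊗ 1#))) ⊗ (x ⊗ F) ≈ (x ⊗ (P ⊗ P)) ⊗ ((Q ⊗ R) ⊗ F)
    rearrange = Solver.solve-∀ ℤ[X]

lemma2 : (i : ℕ) → 1 ≤ i →
    (charPoly (thresholdAdj (G'seq i)) ≈P G'rhs i)
      ⊎ (charPoly (thresholdAdj (G'seq i)) ≈P negP (G'rhs i))
lemma2 zero    ()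
lemma2 (suc j) _ = inj₁ (coeff-≡ (G'.charPoly-G' j))
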